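{- Let $p\ge q\ge 1$ be integers and let $S_{p,q}$ be the double star. Then $\chi'_L(S_{p,q})=p+1$ if $p>q$, and $\chi'_L(S_{p,q})=p+2$ if $p=q$.
   Context: The double star $S_{p,q}$ is the tree consisting of two adjacent vertices $v,u$, where $v$ is adjacent to $p$ further leaves and $u$ is adjacent to $q$ further leaves. For a proper edge coloring $c:E(G)\to\{1,\dots,k\}$ of a connected graph $G$, let $\pi=(\mathcal{C}_1,\dots,\mathcal{C}_k)$ be the ordered partition of $E(G)$ into color classes. For a vertex $v$ and an edge $e=xy$, $d(v,e)=\min\{d(v,x),d(v,y)\}$, and $d(v,\mathcal{C}_i)=\min\{d(v,e): e\in\mathcal{C}_i\}$. The edge color code of $v$ is $c_\pi(v)=(d(v,\mathcal{C}_1),\dots,d(v,\mathcal{C}_k))$. The coloring is an edge-locating coloring if distinct vertices have distinct edge color codes; $\chi'_L(G)$ is the minimum number of colors in an edge-locating coloring of $G$. -}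

module Defs where

open import Data.Nat using (ℕ; zero; suc; _+_; _<_)
open import Data.Fin using (Fin; zero; suc; splitAt; _↑ˡ_; _↑ʳ_)
open import Data.Product using (Σ; ∃; _×_; _,_; proj₁; proj₂)
open import Data.Sum using (_⊎_; inj₁; inj₂)
open import Relation.Binary.PropositionalEquality using (_≡_; _≢_)
open import Relation.Nullary using (¬_)

record Graph : Set where
  field
    n    : ℕ
    m    : ℕ
    ends : Fin m → Fin n × Fin n

open Graph public

Vertex : Graph → Set
Vertex G = Fin (n G)

Edge : Graph → Set
Edge G = Fin (m G)

Incident : (G : Graph) → Fin (m G) → Fin (n G) → Set
Incident G e x = (proj₁ (ends G e) ≡ x) ⊎ (proj₂ (ends G e) ≡ x)

Adj : (G : Graph) → Fin (n G) → Fin (n G) → Set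
Adj G x y = ∃ λ e → ((proj₁ (ends G e) ≡ x) × (proj₂ (ends G e) ≡ y))
                   ⊎ ((proj₁ (ends G e) ≡ y) × (proj₂ (ends G e) ≡ x))

Within : (G : Graph) → ℕ → Fin (n G) → Fin (n G) → Set
Within G zero    x y = x ≡ y
Within G (suc r) x y = (x ≡ y) ⊎ (∃ λ z → Adj G x z × Within G r z y)

IsDist : (G : Graph) → Fin (n G) → Fin (n G) → ℕ → Set
IsDist G x y d = Within G d x y × (∀ d' → d' < d → ¬ Within G d' x y)

Connected : Graph → Set
Connected G = ∀ x y → ∃ λ d → Within G d x y

Colouring : Graph → ℕ → Set
Colouring G k = Fin (m G) → Fin k

Proper : (G : Graph) {k : ℕ} → Colouring G k → Set
Proper G c = ∀ e f x → e ≢ f → Incident G e x → Incident G f x → c e ≢ c f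

-- every colour class is nonempty (c induces an ordered partition into k classes)
AllColoursUsed : (G : Graph) {k : ℕ} → Colouring G k → Set
AllColoursUsed G c = ∀ i → ∃ λ e → c e ≡ i

-- d(v,e) ≤ r  iff  min(d(v,x), d(v,y)) ≤ r  where e = xy
EdgeWithin : (G : Graph) → ℕ → Fin (n G) → Fin (m G) → Set
EdgeWithin G r v e = Within G r v (proj₁ (ends G e)) ⊎ Within G r v (proj₂ (ends G e))

ClassWithin : (G : Graph) {k : ℕ} → Colouring G k → ℕ → Fin (n G) → Fin k → Set
ClassWithin G c r v i = ∃ λ e → (c e ≡ i) × EdgeWithin G r v e

IsClassDist : (G : Graph) {k : ℕ} → Colouring G k → Fin (n G) → Fin k → ℕ → Set
IsClassDist G c v i d = ClassWithin G c d v i × (∀ d' → d' < d → ¬ ClassWithin G c d' v i)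

CodesDiffer : (G : Graph) {k : ℕ} → Colouring G k → Fin (n G) → Fin (n G) → Set
CodesDiffer G c u v = ∃ λ i → ∃ λ d₁ → ∃ λ d₂ →
  IsClassDist G c u i d₁ × IsClassDist G c v i d₂ × (d₁ ≢ d₂)

EdgeLocating : (G : Graph) {k : ℕ} → Colouring G k → Set
EdgeLocating G c = ∀ u v → u ≢ v → CodesDiffer G c u v

HasEdgeLocatingColouring : Graph → ℕ → Set
HasEdgeLocatingColouring G k =
  Σ (Colouring G k) λ c → Proper G c × AllColoursUsed G c × EdgeLocating G c

EdgeLocatingChromaticNumber : Graph → ℕ → Set
EdgeLocatingChromaticNumber G N =
  HasEdgeLocatingColouring G N × (∀ k → k < N → ¬ HasEdgeLocatingColouring G k)

-- Double star S_{p,q}: vertices Fin (2 + p + q); vertex 0 = v, vertex 1 = u,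
-- vertices 2 .. p+1 are the p leaves at v, vertices p+2 .. p+q+1 the q leaves at u.
-- Edges Fin (1 + p + q): edge 0 = vu, edge 1+i = v(2+i), edge 1+p+j = u(2+p+j).
doubleStarEnds : (p q : ℕ) → Fin (suc (p + q)) → Fin (suc (suc (p + q))) × Fin (suc (suc (p + q)))
doubleStarEnds p q zero = zero , suc zero
doubleStarEnds p q (suc e) with splitAt p e
... | inj₁ i = zero , suc (suc (i ↑ˡ q))
... | inj₂ j = suc zero , suc (suc (p ↑ʳ j))

DoubleStar : ℕ → ℕ → Graph
DoubleStar p q = record { n = suc (suc (p + q)) ; m = suc (p + q) ; ends = doubleStarEnds p q }

-- The centre v has p + 1 edges, so a proper colouring needs at least p + 1 colours.  If p = q
-- and only p + 1 colours are used, both centres see every colour, so v and u have the all-zero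
-- code.  Conversely, colour vu with a colour of its own and the leaf edges so that some leaf edge
-- at v carries a colour absent at u: that colour separates v from u and the leaves at v from the
-- leaves at u (which are at distance 2 from it), while the colour of vu and the colours of the
-- leaf edges separate everything else.  For p > q the leaf edges at u can reuse the colours of
-- q leaf edges at v, which gives p + 1 colours; for p = q one more colour is needed.
module Submission where

open import Defs
open import Data.Nat using (ℕ; zero; suc; _≤_; _<_; z≤n; s≤s)
open import Data.Nat.Properties using (1+n≰n; <-irrefl; <⇒≤; m<1+n⇒m<n∨m≡n; ≤⇒≯)
open import Data.Fin using (Fin; zero; suc; splitAt; _↑ˡ_; _↑ʳ_; punchOut; toℕ; inject≤; inject₁; fromℕ; fromℕ<)
open import Data.Fin.Properties
  using (0≢1+n; suc-injective; ↑ˡ-injective; ↑ʳ-injective; splitAt-↑ˡ; splitAt-↑ʳ; splitAt⁻¹-↑ˡ; splitAt⁻¹-↑ʳ;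
         punchOut-injective; injective⇒≤; any?; toℕ<n; toℕ-inject≤; toℕ-fromℕ<; inject≤-injective;
         inject₁-injective; fromℕ≢inject₁)
  renaming (_≟_ to _≟ᶠ_)
open import Data.Product using (∃; _×_; _,_; proj₁; proj₂)
open import Data.Sum using (_⊎_; inj₁; inj₂; [_,_]′)
open import Data.Empty using (⊥-elim)
open import Function using (_∘_)
open import Function.Definitions using (Injective)
open import Relation.Binary.PropositionalEquality using (_≡_; _≢_; refl; sym; trans; cong; subst; module ≡-Reasoning)
open import Relation.Nullary using (¬_; yes; no; contradiction)

fin-injective⇒surjective : ∀ {n} {f : Fin n → Fin n} → Injective _≡_ _≡_ f → ∀ i → ∃ λ a → f a ≡ i
fin-injective⇒surjective {suc n} {f} f-inj i with any? (λ a → f a ≟ᶠ i)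
... | yes hit = hit
... | no miss = contradiction (injective⇒≤ punched-injective) 1+n≰n
  where
  punched : Fin (suc n) → Fin n
  punched a = punchOut {i = i} {j = f a} (λ i≡fa → miss (a , sym i≡fa))

  punched-injective : Injective _≡_ _≡_ punched
  punched-injective = f-inj ∘ punchOut-injective {i = i} _ _

module Pendants (G : Graph) where

  Pendant : Vertex G → Vertex G → Set
  Pendant x w = x ≢ w × (∀ e → Incident G e x → Incident G e w)

  pendant-neighbour : ∀ {x w y} → Pendant x w → Adj G x y → y ≡ w
  pendant-neighbour (x≢w , edges-at-w) (e , inj₁ (e₁≡x , e₂≡y)) =
    [ (λ e₁≡w → contradiction (trans (sym e₁≡x) e₁≡w) x≢w)
    , (λ e₂≡w → trans (sym e₂≡y) e₂≡w) ]′ (edges-at-w e (inj₁ e₁≡x))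
  pendant-neighbour (x≢w , edges-at-w) (e , inj₂ (e₁≡y , e₂≡x)) =
    [ (λ e₁≡w → trans (sym e₁≡y) e₁≡w)
    , (λ e₂≡w → contradiction (trans (sym e₂≡x) e₂≡w) x≢w) ]′ (edges-at-w e (inj₂ e₂≡x))

  pendant-edgeWithin-one : ∀ {x w e} → Pendant x w → EdgeWithin G 1 x e → Incident G e w
  pendant-edgeWithin-one {x} {w} {e} pendant = [ at-w inj₁ , at-w inj₂ ]′
    where
    at-w : ∀ {y} → (∀ {z} → y ≡ z → Incident G e z) → Within G 1 x y → Incident G e w
    at-w end (inj₁ x≡y)             = proj₂ pendant e (end (sym x≡y))
    at-w end (inj₂ (z , x~z , z≡y)) = subst (Incident G e) (pendant-neighbour pendant x~z) (end (sym z≡y))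

module EdgeColouring (G : Graph) {k : ℕ} (c : Colouring G k) where

  open Pendants G public

  Misses : Vertex G → Fin k → Set
  Misses x i = ∀ e → Incident G e x → c e ≢ i

  SeesEveryColour : Vertex G → Set
  SeesEveryColour x = ∀ i → ClassWithin G c 0 x i

  incident⇒classWithin : ∀ {x e} → Incident G e x → ClassWithin G c 0 x (c e)
  incident⇒classWithin (inj₁ h) = _ , refl , inj₁ (sym h)
  incident⇒classWithin (inj₂ h) = _ , refl , inj₂ (sym h)

  edgeWithin-zero : ∀ {x e} → EdgeWithin G 0 x e → Incident G e x
  edgeWithin-zero (inj₁ h) = inj₁ (sym h)
  edgeWithin-zero (inj₂ h) = inj₂ (sym h)

  misses⇒¬classWithin : ∀ {x i} → Misses x i → ¬ ClassWithin G c 0 x i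
  misses⇒¬classWithin miss (e , ce≡i , near) = miss e (edgeWithin-zero near) ce≡i

  classDist-incident : ∀ {x e} → Incident G e x → IsClassDist G c x (c e) 0
  classDist-incident h = incident⇒classWithin h , λ _ ()

  classDist-one : ∀ {x i} → Misses x i → ClassWithin G c 1 x i → IsClassDist G c x i 1
  classDist-one miss near = near , λ { zero _ → misses⇒¬classWithin miss ; (suc _) (s≤s ()) }

  classDist≡0 : ∀ {x i d} → IsClassDist G c x i d → ClassWithin G c 0 x i → d ≡ 0
  classDist≡0 {d = zero}  _          _    = refl
  classDist≡0 {d = suc d} (_ , least) near = contradiction near (least 0 (s≤s z≤n))

  classDist-two : ∀ {x w i} → Pendant x w → Misses w i → ClassWithin G c 2 x i → IsClassDist G c x i 2
  classDist-two {x} {w} {i} pendant miss near = near , least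
    where
    least : ∀ d → d < 2 → ¬ ClassWithin G c d x i
    least zero          _ (e , ce≡i , at) = miss e (proj₂ pendant e (edgeWithin-zero at)) ce≡i
    least (suc zero)    _ (e , ce≡i , at) = miss e (pendant-edgeWithin-one pendant at) ce≡i
    least (suc (suc _)) (s≤s (s≤s ()))

  classWithin-one : ∀ {x y} e → Adj G x y → Incident G e y → ClassWithin G c 1 x (c e)
  classWithin-one e x~y (inj₁ h) = e , refl , inj₁ (inj₂ (_ , x~y , sym h))
  classWithin-one e x~y (inj₂ h) = e , refl , inj₂ (inj₂ (_ , x~y , sym h))

  classWithin-two : ∀ {x y z} e → Adj G x y → Adj G y z → Incident G e z → ClassWithin G c 2 x (c e)
  classWithin-two e x~y y~z (inj₁ h) = e , refl , inj₁ (inj₂ (_ , x~y , inj₂ (_ , y~z , sym h)))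
  classWithin-two e x~y y~z (inj₂ h) = e , refl , inj₂ (inj₂ (_ , x~y , inj₂ (_ , y~z , sym h)))

  codesDiffer-sym : ∀ {x y} → CodesDiffer G c x y → CodesDiffer G c y x
  codesDiffer-sym (i , d₁ , d₂ , dist₁ , dist₂ , d₁≢d₂) = i , d₂ , d₁ , dist₂ , dist₁ , d₁≢d₂ ∘ sym

  codesDiffer-incident : ∀ {x y e d} → Incident G e x → IsClassDist G c y (c e) (suc d) → CodesDiffer G c x y
  codesDiffer-incident h dist = _ , 0 , _ , classDist-incident h , dist , λ ()

  module _ (proper : Proper G c) {r w} {f : Fin r → Edge G}
           (f-inj : Injective _≡_ _≡_ f) (f-at-w : ∀ a → Incident G (f a) w) where

    incident-colours-injective : Injective _≡_ _≡_ (c ∘ f)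
    incident-colours-injective {a} {b} same with a ≟ᶠ b
    ... | yes a≡b = a≡b
    ... | no a≢b  = contradiction same (proper (f a) (f b) w (a≢b ∘ f-inj) (f-at-w a) (f-at-w b))

    degree≤colours : r ≤ k
    degree≤colours = injective⇒≤ incident-colours-injective

  full-degree⇒seesEveryColour : Proper G c → ∀ {w} {f : Fin k → Edge G} → Injective _≡_ _≡_ f →
                                 (∀ a → Incident G (f a) w) → SeesEveryColour w
  full-degree⇒seesEveryColour proper f-inj f-at-w i
    with fin-injective⇒surjective (incident-colours-injective proper f-inj f-at-w) i
  ... | a , refl = incident⇒classWithin (f-at-w a)

  seesEveryColour⇒¬codesDiffer : ∀ {x y} → SeesEveryColour x → SeesEveryColour y → ¬ CodesDiffer G c x y
  seesEveryColour⇒¬codesDiffer all-x all-y (i , _ , _ , dist-x , dist-y , d₁≢d₂) =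
    d₁≢d₂ (trans (classDist≡0 dist-x (all-x i)) (sym (classDist≡0 dist-y (all-y i))))

module DoubleStarStructure (p q : ℕ) where

  G : Graph
  G = DoubleStar p q

  open Pendants G using (Pendant)

  Vx : Set
  Vx = Vertex G

  Ed : Set
  Ed = Edge G

  v u : Vx
  v = zero
  u = suc zero

  leafV : Fin p → Vx
  leafV a = suc (suc (a ↑ˡ q))

  leafU : Fin q → Vx
  leafU b = suc (suc (p ↑ʳ b))

  vu : Ed
  vu = zero

  edgeV : Fin p → Ed
  edgeV a = suc (a ↑ˡ q)

  edgeU : Fin q → Ed
  edgeU b = suc (p ↑ʳ b)

  data VertexView : Vx → Set where
    is-v     : VertexView v
    is-u     : VertexView u
    is-leafV : ∀ a → VertexView (leafV a)
    is-leafU : ∀ b → VertexView (leafU b)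

  vertexView : ∀ x → VertexView x
  vertexView zero = is-v
  vertexView (suc zero) = is-u
  vertexView (suc (suc y)) with splitAt p y in eq
  ... | inj₁ a = subst (λ y → VertexView (suc (suc y))) (splitAt⁻¹-↑ˡ eq) (is-leafV a)
  ... | inj₂ b = subst (λ y → VertexView (suc (suc y))) (splitAt⁻¹-↑ʳ eq) (is-leafU b)

  data EdgeView : Ed → Set where
    is-vu    : EdgeView vu
    is-edgeV : ∀ a → EdgeView (edgeV a)
    is-edgeU : ∀ b → EdgeView (edgeU b)

  edgeView : ∀ e → EdgeView e
  edgeView zero = is-vu
  edgeView (suc y) with splitAt p y in eq
  ... | inj₁ a = subst (λ y → EdgeView (suc y)) (splitAt⁻¹-↑ˡ eq) (is-edgeV a)
  ... | inj₂ b = subst (λ y → EdgeView (suc y)) (splitAt⁻¹-↑ʳ eq) (is-edgeU b)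

  leafV-injective : ∀ {a a'} → leafV a ≡ leafV a' → a ≡ a'
  leafV-injective = ↑ˡ-injective q _ _ ∘ suc-injective ∘ suc-injective

  leafU-injective : ∀ {b b'} → leafU b ≡ leafU b' → b ≡ b'
  leafU-injective = ↑ʳ-injective p _ _ ∘ suc-injective ∘ suc-injective

  leafU≢leafV : ∀ {a b} → leafU b ≢ leafV a
  leafU≢leafV {a} {b} eq = contradiction splits-both λ ()
    where
    open ≡-Reasoning
    splits-both : inj₂ b ≡ inj₁ a
    splits-both = begin
      inj₂ b              ≡⟨ sym (splitAt-↑ʳ p q b) ⟩
      splitAt p (p ↑ʳ b)  ≡⟨ cong (splitAt p) (suc-injective (suc-injective eq)) ⟩
      splitAt p (a ↑ˡ q)  ≡⟨ splitAt-↑ˡ p a q ⟩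
      inj₁ a              ∎

  ends-edgeV : ∀ a → ends G (edgeV a) ≡ (v , leafV a)
  ends-edgeV a rewrite splitAt-↑ˡ p a q = refl

  ends-edgeU : ∀ b → ends G (edgeU b) ≡ (u , leafU b)
  ends-edgeU b rewrite splitAt-↑ʳ p q b = refl

  incident-edgeV : ∀ {a x} → Incident G (edgeV a) x → v ≡ x ⊎ leafV a ≡ x
  incident-edgeV {a} {x} = subst (λ xy → proj₁ xy ≡ x ⊎ proj₂ xy ≡ x) (ends-edgeV a)

  incident-edgeU : ∀ {b x} → Incident G (edgeU b) x → u ≡ x ⊎ leafU b ≡ x
  incident-edgeU {b} {x} = subst (λ xy → proj₁ xy ≡ x ⊎ proj₂ xy ≡ x) (ends-edgeU b)

  edgeV-at-v : ∀ a → Incident G (edgeV a) v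
  edgeV-at-v a = inj₁ (cong proj₁ (ends-edgeV a))

  edgeV-at-leafV : ∀ a → Incident G (edgeV a) (leafV a)
  edgeV-at-leafV a = inj₂ (cong proj₂ (ends-edgeV a))

  edgeU-at-u : ∀ b → Incident G (edgeU b) u
  edgeU-at-u b = inj₁ (cong proj₁ (ends-edgeU b))

  edgeU-at-leafU : ∀ b → Incident G (edgeU b) (leafU b)
  edgeU-at-leafU b = inj₂ (cong proj₂ (ends-edgeU b))

  vu-at-v : Incident G vu v
  vu-at-v = inj₁ refl

  vu-at-u : Incident G vu u
  vu-at-u = inj₂ refl

  edges-at-v : ∀ e → Incident G e v → e ≡ vu ⊎ ∃ λ a → e ≡ edgeV a
  edges-at-v e h with edgeView e
  ... | is-vu      = inj₁ refl
  ... | is-edgeV a = inj₂ (a , refl)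
  ... | is-edgeU b = [ (λ ()) , (λ ()) ]′ (incident-edgeU h)

  edges-at-u : ∀ e → Incident G e u → e ≡ vu ⊎ ∃ λ b → e ≡ edgeU b
  edges-at-u e h with edgeView e
  ... | is-vu      = inj₁ refl
  ... | is-edgeV a = [ (λ ()) , (λ ()) ]′ (incident-edgeV h)
  ... | is-edgeU b = inj₂ (b , refl)

  edge-at-leafV : ∀ {a} e → Incident G e (leafV a) → e ≡ edgeV a
  edge-at-leafV e h with edgeView e
  ... | is-vu       = [ (λ ()) , (λ ()) ]′ h
  ... | is-edgeV a' = [ (λ ()) , cong edgeV ∘ leafV-injective ]′ (incident-edgeV h)
  ... | is-edgeU b  = [ (λ ()) , ⊥-elim ∘ leafU≢leafV ]′ (incident-edgeU h)

  edge-at-leafU : ∀ {b} e → Incident G e (leafU b) → e ≡ edgeU b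
  edge-at-leafU e h with edgeView e
  ... | is-vu       = [ (λ ()) , (λ ()) ]′ h
  ... | is-edgeV a  = [ (λ ()) , ⊥-elim ∘ leafU≢leafV ∘ sym ]′ (incident-edgeV h)
  ... | is-edgeU b' = [ (λ ()) , cong edgeU ∘ leafU-injective ]′ (incident-edgeU h)

  leafU-pendant : ∀ b → Pendant (leafU b) u
  leafU-pendant b = (λ ()) , λ e h →
    subst (λ e' → Incident G e' u) (sym (edge-at-leafU e h)) (edgeU-at-u b)

  leafV~v : ∀ a → Adj G (leafV a) v
  leafV~v a = edgeV a , inj₂ (cong proj₁ (ends-edgeV a) , cong proj₂ (ends-edgeV a))

  leafU~u : ∀ b → Adj G (leafU b) u
  leafU~u b = edgeU b , inj₂ (cong proj₁ (ends-edgeU b) , cong proj₂ (ends-edgeU b))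

  u~v : Adj G u v
  u~v = vu , inj₂ (refl , refl)

  edgeV-injective : ∀ {a a'} → edgeV a ≡ edgeV a' → a ≡ a'
  edgeV-injective = ↑ˡ-injective q _ _ ∘ suc-injective

  edgeU-injective : ∀ {b b'} → edgeU b ≡ edgeU b' → b ≡ b'
  edgeU-injective = ↑ʳ-injective p _ _ ∘ suc-injective

  -- zero ↑ˡ q is vu and suc a ↑ˡ q is edgeV a
  edgesAtV : Fin (suc p) → Ed
  edgesAtV a = a ↑ˡ q

  edgesAtV-injective : Injective _≡_ _≡_ edgesAtV
  edgesAtV-injective = ↑ˡ-injective q _ _

  edgesAtV-at-v : ∀ a → Incident G (edgesAtV a) v
  edgesAtV-at-v zero    = vu-at-v
  edgesAtV-at-v (suc a) = edgeV-at-v a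

  edgesAtU : Fin (suc q) → Ed
  edgesAtU zero    = vu
  edgesAtU (suc b) = edgeU b

  edgesAtU-injective : Injective _≡_ _≡_ edgesAtU
  edgesAtU-injective {zero}  {zero}  _  = refl
  edgesAtU-injective {suc b} {suc b'} eq = cong suc (edgeU-injective eq)

  edgesAtU-at-u : ∀ b → Incident G (edgesAtU b) u
  edgesAtU-at-u zero    = vu-at-u
  edgesAtU-at-u (suc b) = edgeU-at-u b

  module ProperColouring {k} (c : Colouring G k) (proper : Proper G c) where

    open EdgeColouring G c

    edgeV-colours-distinct : ∀ {a a'} → a ≢ a' → c (edgeV a) ≢ c (edgeV a')
    edgeV-colours-distinct a≢a' = proper _ _ v (a≢a' ∘ edgeV-injective) (edgeV-at-v _) (edgeV-at-v _)

    edgeU-colours-distinct : ∀ {b b'} → b ≢ b' → c (edgeU b) ≢ c (edgeU b')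
    edgeU-colours-distinct b≢b' = proper _ _ u (b≢b' ∘ edgeU-injective) (edgeU-at-u _) (edgeU-at-u _)

    edgeV≢vu-colour : ∀ a → c (edgeV a) ≢ c vu
    edgeV≢vu-colour a = proper _ _ v (λ ()) (edgeV-at-v a) vu-at-v

    edgeU≢vu-colour : ∀ b → c (edgeU b) ≢ c vu
    edgeU≢vu-colour b = proper _ _ u (λ ()) (edgeU-at-u b) vu-at-u

    dist-leafV-one : ∀ {a e} → Incident G e v → c (edgeV a) ≢ c e → IsClassDist G c (leafV a) (c e) 1
    dist-leafV-one {a} {e} h different = classDist-one misses (classWithin-one e (leafV~v a) h)
      where
      misses : Misses (leafV a) _
      misses f at = different ∘ subst (λ f' → c f' ≡ _) (edge-at-leafV f at)

    dist-leafU-one : ∀ {b e} → Incident G e u → c (edgeU b) ≢ c e → IsClassDist G c (leafU b) (c e) 1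
    dist-leafU-one {b} {e} h different = classDist-one misses (classWithin-one e (leafU~u b) h)
      where
      misses : Misses (leafU b) _
      misses f at = different ∘ subst (λ f' → c f' ≡ _) (edge-at-leafU f at)

    dist-u-one : ∀ {e} → Incident G e v → Misses u (c e) → IsClassDist G c u (c e) 1
    dist-u-one {e} h misses = classDist-one misses (classWithin-one e u~v h)

    dist-leafU-two : ∀ {b e} → Incident G e v → Misses u (c e) → IsClassDist G c (leafU b) (c e) 2
    dist-leafU-two {b} {e} h misses =
      classDist-two (leafU-pendant b) misses (classWithin-two e (leafU~u b) u~v h)

    module _ (a★ : Fin p) (u-misses : Misses u (c (edgeV a★))) where

      separate : ∀ {x y} → VertexView x → VertexView y → x ≢ y → CodesDiffer G c x y
      separate is-v is-v x≢y = contradiction refl x≢y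
      separate is-u is-u x≢y = contradiction refl x≢y
      separate is-v is-u _ = codesDiffer-incident (edgeV-at-v a★) (dist-u-one (edgeV-at-v a★) u-misses)
      separate is-v (is-leafV a) _ = codesDiffer-incident vu-at-v (dist-leafV-one vu-at-v (edgeV≢vu-colour a))
      separate is-v (is-leafU b) _ = codesDiffer-incident vu-at-v (dist-leafU-one vu-at-u (edgeU≢vu-colour b))
      separate is-u (is-leafV a) _ = codesDiffer-incident vu-at-u (dist-leafV-one vu-at-v (edgeV≢vu-colour a))
      separate is-u (is-leafU b) _ = codesDiffer-incident vu-at-u (dist-leafU-one vu-at-u (edgeU≢vu-colour b))
      separate (is-leafV a) (is-leafV a') x≢y =
        codesDiffer-incident (edgeV-at-leafV a)
          (dist-leafV-one (edgeV-at-v a) (edgeV-colours-distinct (x≢y ∘ cong leafV ∘ sym)))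
      separate (is-leafU b) (is-leafU b') x≢y =
        codesDiffer-incident (edgeU-at-leafU b)
          (dist-leafU-one (edgeU-at-u b) (edgeU-colours-distinct (x≢y ∘ cong leafU ∘ sym)))
      separate (is-leafV a) (is-leafU b) _ with a ≟ᶠ a★
      ... | yes refl = codesDiffer-incident (edgeV-at-leafV a) (dist-leafU-two (edgeV-at-v a) u-misses)
      ... | no a≢a★  = _ , 1 , 2 , dist-leafV-one (edgeV-at-v a★) (edgeV-colours-distinct a≢a★)
                                 , dist-leafU-two (edgeV-at-v a★) u-misses , λ ()
      separate x@is-u         y@is-v         x≢y = codesDiffer-sym (separate y x (x≢y ∘ sym))
      separate x@(is-leafV _) y@is-v         x≢y = codesDiffer-sym (separate y x (x≢y ∘ sym))
      separate x@(is-leafV _) y@is-u         x≢y = codesDiffer-sym (separate y x (x≢y ∘ sym))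
      separate x@(is-leafU _) y@is-v         x≢y = codesDiffer-sym (separate y x (x≢y ∘ sym))
      separate x@(is-leafU _) y@is-u         x≢y = codesDiffer-sym (separate y x (x≢y ∘ sym))
      separate x@(is-leafU _) y@(is-leafV _) x≢y = codesDiffer-sym (separate y x (x≢y ∘ sym))

      edgeLocating : EdgeLocating G c
      edgeLocating x y = separate (vertexView x) (vertexView y)

  fewer-colours-impossible : ∀ k → k < suc p → ¬ HasEdgeLocatingColouring G k
  fewer-colours-impossible k k<p+1 (c , proper , _) =
    ≤⇒≯ (EdgeColouring.degree≤colours G c proper edgesAtV-injective edgesAtV-at-v) k<p+1

  module LeafColouring {k} (cl : Fin p → Fin k) (cm : Fin q → Fin k) where

    colouring : Colouring G (suc k)
    colouring zero    = zero
    colouring (suc e) = suc ([ cl , cm ]′ (splitAt p e))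

    open EdgeColouring G colouring using (Misses)

    colour-edgeV : ∀ a → colouring (edgeV a) ≡ suc (cl a)
    colour-edgeV a = cong (suc ∘ [ cl , cm ]′) (splitAt-↑ˡ p a q)

    colour-edgeU : ∀ b → colouring (edgeU b) ≡ suc (cm b)
    colour-edgeU b = cong (suc ∘ [ cl , cm ]′) (splitAt-↑ʳ p q b)

    centre-colours-distinct : ∀ {r} (g : Fin r → Ed) {h : Fin r → Fin k} →
                              (∀ a → colouring (g a) ≡ suc (h a)) → Injective _≡_ _≡_ h →
                              ∀ {e f} → e ≢ f →
                              e ≡ vu ⊎ ∃ (λ a → e ≡ g a) → f ≡ vu ⊎ ∃ (λ a → f ≡ g a) →
                              colouring e ≢ colouring f
    centre-colours-distinct _ _ _ e≢f (inj₁ refl) (inj₁ refl) = contradiction refl e≢f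
    centre-colours-distinct _ col _ _ (inj₁ refl) (inj₂ (a , refl)) = 0≢1+n ∘ λ same → trans same (col a)
    centre-colours-distinct _ col _ _ (inj₂ (a , refl)) (inj₁ refl) = 0≢1+n ∘ λ same → trans (sym same) (col a)
    centre-colours-distinct g col h-inj e≢f (inj₂ (a , refl)) (inj₂ (a' , refl)) same =
      e≢f (cong g (h-inj (suc-injective (trans (sym (col a)) (trans same (col a'))))))

    proper : Injective _≡_ _≡_ cl → Injective _≡_ _≡_ cm → Proper G colouring
    proper cl-inj cm-inj e f x e≢f e-at f-at with vertexView x
    ... | is-v       = centre-colours-distinct edgeV colour-edgeV cl-inj e≢f (edges-at-v e e-at) (edges-at-v f f-at)
    ... | is-u       = centre-colours-distinct edgeU colour-edgeU cm-inj e≢f (edges-at-u e e-at) (edges-at-u f f-at)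
    ... | is-leafV a = contradiction (trans (edge-at-leafV e e-at) (sym (edge-at-leafV f f-at))) e≢f
    ... | is-leafU b = contradiction (trans (edge-at-leafU e e-at) (sym (edge-at-leafU f f-at))) e≢f

    allColoursUsed : (∀ j → (∃ λ a → cl a ≡ j) ⊎ (∃ λ b → cm b ≡ j)) → AllColoursUsed G colouring
    allColoursUsed covers zero = vu , refl
    allColoursUsed covers (suc j) with covers j
    ... | inj₁ (a , refl) = edgeV a , colour-edgeV a
    ... | inj₂ (b , refl) = edgeU b , colour-edgeU b

    u-misses : ∀ {a★} → (∀ b → cm b ≢ cl a★) → Misses u (colouring (edgeV a★))
    u-misses {a★} unused e e-at same with edges-at-u e e-at
    ... | inj₁ refl       = 0≢1+n (trans same (colour-edgeV a★))
    ... | inj₂ (b , refl) = unused b (suc-injective (trans (sym (colour-edgeU b)) (trans same (colour-edgeV a★))))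

    edgeLocatingColouring : Injective _≡_ _≡_ cl → Injective _≡_ _≡_ cm →
                            (∀ j → (∃ λ a → cl a ≡ j) ⊎ (∃ λ b → cm b ≡ j)) →
                            ∀ a★ → (∀ b → cm b ≢ cl a★) → HasEdgeLocatingColouring G (suc k)
    edgeLocatingColouring cl-inj cm-inj covers a★ unused =
      colouring , proper cl-inj cm-inj , allColoursUsed covers ,
      ProperColouring.edgeLocating colouring (proper cl-inj cm-inj) a★ (u-misses unused)

balanced-needs-extra-colour : ∀ p → ¬ HasEdgeLocatingColouring (DoubleStar p p) (suc p)
balanced-needs-extra-colour p (c , proper , _ , locating) =
  seesEveryColour⇒¬codesDiffer (full-degree⇒seesEveryColour proper edgesAtV-injective edgesAtV-at-v)
                                (full-degree⇒seesEveryColour proper edgesAtU-injective edgesAtU-at-u)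
                                (locating v u (λ ()))
  where
  open DoubleStarStructure p p
  open EdgeColouring G c

unbalanced-colouring : ∀ {p q} → q < p → HasEdgeLocatingColouring (DoubleStar p q) (suc p)
unbalanced-colouring {p} {q} q<p =
  edgeLocatingColouring (λ same → same) (inject≤-injective _ _ _ _) (λ j → inj₁ (j , refl))
                        (fromℕ< q<p) unused
  where
  open DoubleStarStructure p q
  open LeafColouring (λ a → a) (λ b → inject≤ b (<⇒≤ q<p))

  unused : ∀ b → inject≤ b (<⇒≤ q<p) ≢ fromℕ< q<p
  unused b same = <-irrefl (trans (sym (toℕ-inject≤ b _)) (trans (cong toℕ same) (toℕ-fromℕ< q<p))) (toℕ<n b)

balanced-colouring : ∀ p → HasEdgeLocatingColouring (DoubleStar (suc p) (suc p)) (suc (suc (suc p)))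
balanced-colouring p =
  edgeLocatingColouring suc-injective inject₁-injective covers (fromℕ p) (λ _ → fromℕ≢inject₁ ∘ sym)
  where
  open DoubleStarStructure (suc p) (suc p)
  open LeafColouring suc inject₁

  covers : ∀ j → (∃ λ a → Fin.suc a ≡ j) ⊎ (∃ λ b → inject₁ b ≡ j)
  covers zero    = inj₂ (zero , refl)
  covers (suc j) = inj₁ (j , refl)

theorem20 : (p q : ℕ) → 1 ≤ q → q ≤ p →
    (q < p → EdgeLocatingChromaticNumber (DoubleStar p q) (suc p))
    × (p ≡ q → EdgeLocatingChromaticNumber (DoubleStar p q) (suc (suc p)))
theorem20 p (suc q) (s≤s z≤n) _ = unbalanced , balanced
  where
  open DoubleStarStructure using (fewer-colours-impossible)

  unbalanced : suc q < p → EdgeLocatingChromaticNumber (DoubleStar p (suc q)) (suc p)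
  unbalanced q<p = unbalanced-colouring q<p , fewer-colours-impossible p (suc q)

  balanced : p ≡ suc q → EdgeLocatingChromaticNumber (DoubleStar p (suc q)) (suc (suc p))
  balanced refl = balanced-colouring q , below
    where
    below : ∀ k → k < suc (suc p) → ¬ HasEdgeLocatingColouring (DoubleStar p p) k
    below k k<p+2 with m<1+n⇒m<n∨m≡n k<p+2
    ... | inj₁ k<p+1 = fewer-colours-impossible p p k k<p+1
    ... | inj₂ refl  = balanced-needs-extra-colour p
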